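{- Let $s,t\ge1$ and $n>s+t$. Let $M$ be a continuous multiline queue of type $(s,t,n-s-t)$ with rows $a_1<\cdots<a_s$, $b_1<\cdots<b_{s+t}$, $c_1<\cdots<c_n$, with $c_n=N$ the largest entry, such that there is exactly one wrapping from the second row to the third row. Then the projected word $\omega$ of $M$ satisfies $\omega_1=1$ and $\omega_2=3$ if and only if (1) there exists $1\le i<s$ such that $a_i\to b_{s+t-1}\to c_n$ and $a_{i+1}\to b_{s+t}$, with $b_{s+t}$ bullying $c_1$ by wrapping, and (2) $b_1>c_2$.
   Context: A continuous multiline queue of type $(s,t,n-s-t)$ is a three-row array whose rows are strictly increasing sequences of lengths $s$, $s+t$, $n$, whose $N=n+2s+t$ entries are exactly $1,\ldots,N$, each once. Bully path procedure: initially all entries are available. First, each entry of row 1 starts a bully path; then each still-available entry of row 2 starts a bully path. An entry $x$ on a path bullies (written $x\to y$) the smallest available entry $y$ of the next row larger than $x$, or, if there is none, the smallest available entry of the next row (a wrapping from that row to the next); bullied entries become unavailable and the path continues to row 3. Endpoints of paths starting in row 1 get label 1, those starting in row 2 get label 2, remaining entries of row 3 get label 3. The projected word is $\omega=(\omega_1,\ldots,\omega_n)$, $\omega_k$ the label of $c_k$. "Exactly one wrapping from the second row to the third row" means exactly one bullying step from an entry of row 2 to row 3 is a wrapping. -}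

module Defs where

open import Data.Nat using (ℕ; zero; suc; _+_; _<_; _<ᵇ_; _≡ᵇ_)
open import Data.Bool using (Bool; true; false; not; if_then_else_)
open import Data.List using (List; []; _∷_; _++_; length; filterᵇ; foldl; applyUpTo)
open import Data.List.Membership.Propositional using (_∈_)
open import Data.List.Relation.Unary.Linked using (Linked)
open import Data.List.Relation.Binary.Permutation.Propositional using (_↭_)
open import Data.Maybe using (Maybe; just; nothing)
open import Data.Product using (_×_; _,_; ∃)
open import Relation.Binary.PropositionalEquality using (_≡_)
open import Relation.Nullary.Decidable using (⌊_⌋)
open import Function using (_∘_)

-- 1-based lookup in a list (value 0 when out of range; entries are ≥ 1).
at : List ℕ → ℕ → ℕ
at [] _ = 0
at (x ∷ xs) zero = 0
at (x ∷ xs) (suc zero) = x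
at (x ∷ xs) (suc (suc k)) = at xs (suc k)

-- Continuous multiline queue of type (s , t , n - s - t):
-- rows A, B, C strictly increasing of lengths s, s+t, n, whose entries
-- are exactly 1, …, N (N = n + 2s + t), each once.
record IsCMLQ (s t n : ℕ) (A B C : List ℕ) : Set where
  field
    lenA : length A ≡ s
    lenB : length B ≡ s + t
    lenC : length C ≡ n
    incA : Linked _<_ A
    incB : Linked _<_ B
    incC : Linked _<_ C
    entries : (A ++ B ++ C) ↭ applyUpTo suc (n + s + s + t)

firstGT : ℕ → List ℕ → Maybe ℕ
firstGT x [] = nothing
firstGT x (y ∷ ys) = if x <ᵇ y then just y else firstGT x ys

-- bullying choice among the available entries (kept in increasing order):
-- smallest available entry > x (no wrap), else smallest available (wrap).
pick : ℕ → List ℕ → Maybe (ℕ × Bool)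
pick x ys with firstGT x ys
... | just y = just (y , false)
... | nothing with ys
...   | [] = nothing
...   | y ∷ _ = just (y , true)

remove : ℕ → List ℕ → List ℕ
remove y = filterᵇ (λ z → not (z ≡ᵇ y))

-- an edge (x , y , w): x bullies y, w = true iff it is a wrapping
Edge : Set
Edge = ℕ × ℕ × Bool

record State : Set where
  constructor st
  field
    av2 : List ℕ
    av3 : List ℕ
    e12 : List Edge
    e23 : List Edge
    lab : List (ℕ × ℕ)         -- (entry of row 3, label) for path endpoints

-- a bully path started at x in row 2 (already unavailable / starting there), label ℓ
step23 : ℕ → ℕ → State → State
step23 ℓ x (st a2 a3 f12 f23 lb) with pick x a3
... | nothing = st a2 a3 f12 f23 lb
... | just (z , w) = st a2 (remove z a3) f12 (f23 ++ ((x , z , w) ∷ [])) (lb ++ ((z , ℓ) ∷ []))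

step1 : State → ℕ → State
step1 (st a2 a3 f12 f23 lb) x with pick x a2
... | nothing = st a2 a3 f12 f23 lb
... | just (y , w) = step23 1 y (st (remove y a2) a3 (f12 ++ ((x , y , w) ∷ [])) f23 lb)

memb : ℕ → List ℕ → Bool
memb x [] = false
memb x (y ∷ ys) = if x ≡ᵇ y then true else memb x ys

-- bully paths started at still-available entries of row 2 (label 2);
-- `avail` is the set of row-2 entries still available after phase 1
step2 : List ℕ → State → ℕ → State
step2 avail σ y = if memb y avail then step23 2 y σ else σ

bully : List ℕ → List ℕ → List ℕ → State
bully A B C = foldl (step2 (State.av2 σ₁)) σ₁ B
  where
  σ₁ : State
  σ₁ = foldl step1 (st B C [] [] []) A

labelOf : List (ℕ × ℕ) → ℕ → ℕ
labelOf [] z = 3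
labelOf ((u , ℓ) ∷ r) z = if u ≡ᵇ z then ℓ else labelOf r z

-- projected word, 1-based: ω k = label of c_k
ω : List ℕ → List ℕ → List ℕ → ℕ → ℕ
ω A B C k = labelOf (State.lab (bully A B C)) (at C k)

Bullies12 : List ℕ → List ℕ → List ℕ → ℕ → ℕ → Set
Bullies12 A B C x y = ∃ λ w → (x , y , w) ∈ State.e12 (bully A B C)

Bullies23 : List ℕ → List ℕ → List ℕ → ℕ → ℕ → Set
Bullies23 A B C x y = ∃ λ w → (x , y , w) ∈ State.e23 (bully A B C)

isWrap : Edge → Bool
isWrap (_ , _ , w) = w

wraps23 : List ℕ → List ℕ → List ℕ → ℕ
wraps23 A B C = length (filterᵇ isWrap (State.e23 (bully A B C)))

module Submission where

-- Both bully phases are runs of greedy choices: an edge from x takes the least available entry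
-- of the next row above x, or wraps to the least available entry when there is none.  Suppose
-- ω₁ = 1 and ω₂ = 3.  Then c₂ is never bullied, so it is available when the unique wrap
-- happens; hence the wrap lands on c₁ and starts above c₂, it ends the row-1 path p₀ labelling
-- c₁, and no step can start below c₂, which gives b₁ > c₂.  When p₀ wraps from b = middle p₀,
-- nothing above b is available; as the starts of row-1 paths increase, earlier ascending paths
-- land lower, and this pins b down as b_{s+t}, the entry c_n as the end of an earlier path pₙ,
-- its middle as b_{s+t-1}, and pₙ as the path just before p₀.  Conversely, under (1) the wrap
-- to c₁ continues a row-1 path, and under (2) neither a step nor the wrap can reach c₂.

open import Defs
open import Data.Bool using (Bool; true; false; not; if_then_else_)
open import Data.Bool.Properties using (T-≡)
open import Data.Empty using (⊥; ⊥-elim)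
open import Data.List using (List; []; _∷_; _++_; _∷ʳ_; [_]; length; foldl; map; filterᵇ; applyUpTo)
open import Data.List.Properties
  using (map-++; map-∘; ++-assoc; ++-identityʳ; length-++; length-map; ∷-injective; ∷ʳ-++)
open import Data.List.Membership.Propositional using (_∈_; _∉_)
open import Data.List.Membership.Propositional.Properties
  using (∈-∃++; ∈-++⁺ˡ; ∈-++⁺ʳ; ∈-++⁻; ∈-map⁺; ∈-map⁻; ∈-filter⁺; ∈-filter⁻; ∈-applyUpTo⁻)
open import Data.List.Relation.Unary.Any using (here; there)
open import Data.List.Relation.Unary.All as All using (All; []; _∷_)
import Data.List.Relation.Unary.All.Properties as Allₚ
open import Data.List.Relation.Unary.AllPairs using (AllPairs; []; _∷_)
import Data.List.Relation.Unary.AllPairs.Properties as AllPairsₚ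
open import Data.List.Relation.Unary.Linked.Properties using (Linked⇒AllPairs)
open import Data.List.Relation.Unary.Unique.Propositional using (Unique)
import Data.List.Relation.Unary.Unique.Propositional.Properties as Uniqueₚ
open import Data.List.Relation.Binary.Permutation.Propositional using (_↭_; ↭-sym; ↭⇒↭ₛ)
open import Data.List.Relation.Binary.Permutation.Propositional.Properties using (∈-resp-↭)
open import Data.List.Relation.Binary.Permutation.Setoid.Properties using (Unique-resp-↭)
open import Data.Maybe using (Maybe; just; nothing)
open import Data.Nat using (ℕ; suc; _+_; _∸_; _≤_; _<_; _<ᵇ_; _≡ᵇ_; z≤n; s≤s)
open import Data.Nat.Properties
open import Data.Product using (_×_; _,_; ∃; ∃₂; proj₁; proj₂; map₁)
open import Data.Sum using (_⊎_; inj₁; inj₂; [_,_]′)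
open import Function using (_∘_; _∘′_; _⇔_; mk⇔; Equivalence)
open import Relation.Binary.PropositionalEquality
  using (_≡_; _≢_; refl; sym; trans; cong; cong₂; subst; subst₂; setoid; module ≡-Reasoning)
open import Relation.Nullary using (¬_; yes; no; contradiction)
open import Relation.Nullary.Decidable using (T?)
open import Relation.Nullary.Reflects using (Reflects; ofʸ; ofⁿ; fromEquivalence)
open import Data.List.Membership.DecPropositional _≟_ using (_∈?_)

Increasing : List ℕ → Set
Increasing = AllPairs _<_

increasing-before : ∀ P {x Q u} → Increasing (P ++ x ∷ Q) → u ∈ P → u < x
increasing-before (p ∷ P) (p< ∷ _)  (here refl) = All.lookup p< (∈-++⁺ʳ P (here refl))
increasing-before (p ∷ P) (_ ∷ ↑)   (there u∈)  = increasing-before P ↑ u∈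

∷ʳ-split : ∀ {A : Set} (E P : List A) e e′ Q → E ∷ʳ e ≡ P ++ e′ ∷ Q →
  (P ≡ E × e′ ≡ e) ⊎ ∃ λ Q′ → E ≡ P ++ e′ ∷ Q′
∷ʳ-split []      []          e e′ Q refl = inj₁ (refl , refl)
∷ʳ-split []      (_ ∷ [])    e e′ Q ()
∷ʳ-split []      (_ ∷ _ ∷ _) e e′ Q ()
∷ʳ-split (x ∷ E) []          e e′ Q refl = inj₂ (E , refl)
∷ʳ-split (x ∷ E) (y ∷ P)     e e′ Q eq with refl , eq′ ← ∷-injective eq with ∷ʳ-split E P e e′ Q eq′
... | inj₁ (refl , e′≡e) = inj₁ (refl , e′≡e)
... | inj₂ (Q′ , refl)   = inj₂ (Q′ , refl)

map-∷ʳ : ∀ {A B : Set} (f : A → B) xs x → map f (xs ∷ʳ x) ≡ map f xs ∷ʳ f x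
map-∷ʳ f xs x = map-++ f xs [ x ]

length-∷ʳ-+ : ∀ {A B : Set} (xs : List A) x (ys : List B) {y} →
  length xs + length (y ∷ ys) ≡ length (xs ∷ʳ x) + length ys
length-∷ʳ-+ xs x ys = sym (trans (cong (_+ length ys) (length-++ xs)) (+-assoc (length xs) 1 (length ys)))

unique-++-disjoint : ∀ {A : Set} (xs : List A) {ys x y} → Unique (xs ++ ys) → x ∈ xs → y ∈ ys → x ≢ y
unique-++-disjoint (a ∷ xs) (a≢ ∷ _) (here refl) y∈ = All.lookup a≢ (∈-++⁺ʳ xs y∈)
unique-++-disjoint (a ∷ xs) (_ ∷ u)  (there x∈)  y∈ = unique-++-disjoint xs u x∈ y∈

unique-++⁻ʳ : ∀ {A : Set} (xs : List A) {ys} → Unique (xs ++ ys) → Unique ys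
unique-++⁻ʳ []       u       = u
unique-++⁻ʳ (_ ∷ xs) (_ ∷ u) = unique-++⁻ʳ xs u

unique-↭-upTo : ∀ {xs} N → xs ↭ applyUpTo suc N → Unique xs
unique-↭-upTo N p =
  Unique-resp-↭ (setoid ℕ) (↭⇒↭ₛ (↭-sym p)) (Uniqueₚ.applyUpTo⁺₁ suc N λ i<j _ → <⇒≢ i<j ∘ suc-injective)

filterᵇ-unique : ∀ {A : Set} (p : A → Bool) xs → length (filterᵇ p xs) ≡ 1 →
  ∃ λ x → x ∈ xs × p x ≡ true × ∀ {y} → y ∈ xs → p y ≡ true → y ≡ x
filterᵇ-unique p xs len with filterᵇ p xs in eq
... | x ∷ [] with x∈xs , px ← ∈-filter⁻ (T? ∘ p) {xs = xs} (subst (x ∈_) (sym eq) (here refl)) =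
  x , x∈xs , Equivalence.to T-≡ px , only
  where
  only : ∀ {y} → y ∈ xs → p y ≡ true → y ≡ x
  only y∈ py with here y≡x ← subst (_ ∈_) eq (∈-filter⁺ (T? ∘ p) y∈ (Equivalence.from T-≡ py)) = y≡x

≡ᵇ-reflects-≡ : ∀ m n → Reflects (m ≡ n) (m ≡ᵇ n)
≡ᵇ-reflects-≡ m n = fromEquivalence (≡ᵇ⇒≡ m n) (≡⇒≡ᵇ m n)

at-∈ : ∀ L {k} → 1 ≤ k → k ≤ length L → at L k ∈ L
at-∈ (x ∷ xs) {1}           _ _         = here refl
at-∈ (x ∷ xs) {suc (suc k)} _ (s≤s k<) = there (at-∈ xs (s≤s z≤n) k<)

∈⇒at : ∀ {L u} → u ∈ L → ∃ λ k → 1 ≤ k × k ≤ length L × at L k ≡ u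
∈⇒at {x ∷ xs} (here refl) = 1 , s≤s z≤n , s≤s z≤n , refl
∈⇒at {x ∷ xs} (there u∈) with k , s≤s z≤n , k≤ , eq ← ∈⇒at u∈ = suc k , s≤s z≤n , s≤s k≤ , eq

at-strictMono : ∀ {L i j} → Increasing L → 1 ≤ i → i < j → j ≤ length L → at L i < at L j
at-strictMono {x ∷ xs} {1} {1} _ _ (s≤s ()) _
at-strictMono {x ∷ xs} {1} {suc (suc j)} (x< ∷ _) _ _ (s≤s j<) = All.lookup x< (at-∈ xs (s≤s z≤n) j<)
at-strictMono {x ∷ xs} {suc (suc i)} {suc (suc j)} (_ ∷ xs↑) _ (s≤s i<j) (s≤s j<) =
  at-strictMono xs↑ (s≤s z≤n) i<j j<

at-mono : ∀ {L i j} → Increasing L → 1 ≤ i → i ≤ j → j ≤ length L → at L i ≤ at L j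
at-mono L↑ 1≤i i≤j j≤ with m≤n⇒m<n∨m≡n i≤j
... | inj₁ i<j  = <⇒≤ (at-strictMono L↑ 1≤i i<j j≤)
... | inj₂ refl = ≤-refl

at-cancel-< : ∀ {L i j} → Increasing L → 1 ≤ j → i ≤ length L → at L i < at L j → i < j
at-cancel-< L↑ 1≤j i≤ lt = ≰⇒> λ j≤i → <⇒≱ lt (at-mono L↑ 1≤j j≤i i≤)

at-++-∷ : ∀ P {x Q} → at (P ++ x ∷ Q) (suc (length P)) ≡ x
at-++-∷ []      = refl
at-++-∷ (_ ∷ P) = at-++-∷ P

at-++-∷-∷ : ∀ P {x x′ Q} → at (P ++ x ∷ x′ ∷ Q) (suc (suc (length P))) ≡ x′
at-++-∷-∷ []      = refl
at-++-∷-∷ (_ ∷ P) = at-++-∷-∷ P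

pred-< : ∀ {m} → 1 ≤ m → m ∸ 1 < m
pred-< (s≤s _) = ≤-refl

-- Greedy runs

src tgt : Edge → ℕ
src (x , _ , _) = x
tgt (_ , y , _) = y

GreedyStep GreedyWrap Greedy : (ℕ → Set) → Edge → Set
GreedyStep av e = av (tgt e) × src e < tgt e × (∀ {u} → av u → src e < u → tgt e ≤ u)
GreedyWrap av e = av (tgt e) × (∀ {u} → av u → u ≤ src e) × (∀ {u} → av u → tgt e ≤ u)
Greedy av e = if isWrap e then GreedyWrap av e else GreedyStep av e

greedy-cases : ∀ {av} e → Greedy av e →
  (isWrap e ≡ false × GreedyStep av e) ⊎ (isWrap e ≡ true × GreedyWrap av e)
greedy-cases (_ , _ , false) g = inj₁ (refl , g)
greedy-cases (_ , _ , true)  g = inj₂ (refl , g)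

greedy-target : ∀ {av} e → Greedy av e → av (tgt e)
greedy-target (_ , _ , false) g = proj₁ g
greedy-target (_ , _ , true)  g = proj₁ g

greedy-wrap : ∀ {av} e → isWrap e ≡ true → Greedy av e → GreedyWrap av e
greedy-wrap (_ , _ , true) _ g = g

greedy-resp : ∀ {av av′ : ℕ → Set} → (∀ {u} → av u → av′ u) → (∀ {u} → av′ u → av u) →
  ∀ e → Greedy av e → Greedy av′ e
greedy-resp to from (_ , _ , false) (a , x<y , least) = to a , x<y , λ a′ → least (from a′)
greedy-resp to from (_ , _ , true)  (a , low , least) = to a , low ∘′ from , least ∘′ from

Avail : List ℕ → List Edge → ℕ → Set
Avail X P u = u ∈ X × u ∉ map tgt P

Avail-++⁻ : ∀ {X u} P R → Avail X (P ++ R) u → Avail X P u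
Avail-++⁻ P R (u∈X , u∉) = u∈X , λ u∈P → u∉ (subst (_ ∈_) (sym (map-++ tgt P R)) (∈-++⁺ˡ u∈P))

Avail-++-≢ : ∀ {X u} P e R → Avail X (P ++ e ∷ R) u → u ≢ tgt e
Avail-++-≢ P e R (_ , u∉) refl = u∉ (subst (_ ∈_) (sym (map-++ tgt P (e ∷ R))) (∈-++⁺ʳ (map tgt P) (here refl)))

Avail-∷ʳ⁺ : ∀ {X u} P e → Avail X P u → u ≢ tgt e → Avail X (P ∷ʳ e) u
Avail-∷ʳ⁺ P e (u∈X , u∉P) u≢ = u∈X , λ u∈ → [ u∉P , (λ { (here u≡) → u≢ u≡ }) ]′
  (∈-++⁻ (map tgt P) (subst (_ ∈_) (map-++ tgt P [ e ]) u∈))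

GreedyRun : List ℕ → List Edge → Set
GreedyRun X E = ∀ P e Q → E ≡ P ++ e ∷ Q → Greedy (Avail X P) e

greedyRun-[] : ∀ {X} → GreedyRun X []
greedyRun-[] []      _ _ ()
greedyRun-[] (_ ∷ _) _ _ ()

greedyRun-∷ʳ : ∀ {X E e} → GreedyRun X E → Greedy (Avail X E) e → GreedyRun X (E ∷ʳ e)
greedyRun-∷ʳ {E = E} {e} run g P e′ Q eq with ∷ʳ-split E P e e′ Q eq
... | inj₁ (refl , refl) = g
... | inj₂ (Q′ , eq′)    = run P e′ Q′ eq′

greedyRun-at : ∀ {X E e} → GreedyRun X E → e ∈ E →
  ∃₂ λ P Q → E ≡ P ++ e ∷ Q × Greedy (Avail X P) e
greedyRun-at run e∈ with P , Q , eq ← ∈-∃++ e∈ = P , Q , eq , run P _ Q eq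

greedyRun-later-target : ∀ {X E P d Q e} → GreedyRun X E → E ≡ P ++ d ∷ Q → e ∈ Q →
  Avail X P (tgt e) × tgt e ≢ tgt d
greedyRun-later-target {X} {P = P} {d} {e = e} run refl e∈Q with Q₁ , Q₂ , refl ← ∈-∃++ e∈Q =
  Avail-++⁻ P (d ∷ Q₁) avail , Avail-++-≢ P d Q₁ avail
  where
  avail : Avail X (P ++ d ∷ Q₁) (tgt e)
  avail = greedy-target _ (run (P ++ d ∷ Q₁) _ Q₂ (sym (++-assoc P (d ∷ Q₁) _)))

greedyRun-tgt-injective : ∀ {X E e e′} → GreedyRun X E → e ∈ E → e′ ∈ E → tgt e ≡ tgt e′ → e ≡ e′
greedyRun-tgt-injective run e∈ e′∈ same with P , Q , refl ← ∈-∃++ e∈ with ∈-++⁻ P e′∈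
... | inj₂ (here refl)  = refl
... | inj₂ (there e′∈Q) = ⊥-elim (proj₂ (greedyRun-later-target run refl e′∈Q) (sym same))
... | inj₁ e′∈P with P₁ , P₂ , refl ← ∈-∃++ e′∈P =
  ⊥-elim (proj₂ (greedyRun-later-target run (++-assoc P₁ (_ ∷ P₂) _) (∈-++⁺ʳ P₂ (here refl))) same)

greedyRun-ascending-after : ∀ {X E P d Q e} → GreedyRun X E → E ≡ P ++ d ∷ Q → e ∈ Q →
  src e < tgt e → src d < src e → src d < tgt d × tgt d < tgt e
greedyRun-ascending-after {d = d} run eq e∈Q e↑ d<e with greedyRun-later-target run eq e∈Q
... | avail , tgt≢ with greedy-cases d (run _ d _ eq)
...   | inj₂ (_ , _ , low , _)     = ⊥-elim (<-irrefl refl (<-≤-trans (<-trans d<e e↑) (low avail)))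
...   | inj₁ (_ , _ , d↑ , least) = d↑ , ≤∧≢⇒< (least avail (<-trans d<e e↑)) (tgt≢ ∘′ sym)

greedyRun-wrap-or-ascending : ∀ {X E e} → GreedyRun X E → e ∈ E → isWrap e ≡ true ⊎ src e < tgt e
greedyRun-wrap-or-ascending {e = e} run e∈ with _ , _ , _ , g ← greedyRun-at run e∈ with greedy-cases e g
... | inj₁ (_ , _ , e↑ , _) = inj₂ e↑
... | inj₂ (wrap , _)       = inj₁ wrap

firstGT-just : ∀ {x y} ys → Increasing ys → firstGT x ys ≡ just y → GreedyStep (_∈ ys) (x , y , false)
firstGT-just {x} {y} (z ∷ zs) (z< ∷ zs↑) eq with x <ᵇ z | <ᵇ-reflects-< x z
... | true | ofʸ x<z with refl ← eq = here refl , x<z , least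
  where
  least : ∀ {u} → u ∈ z ∷ zs → x < u → z ≤ u
  least (here refl) _ = ≤-refl
  least (there u∈zs) _ = <⇒≤ (All.lookup z< u∈zs)
... | false | ofⁿ x≮z with y∈zs , x<y , least ← firstGT-just zs zs↑ eq = there y∈zs , x<y , least′
  where
  least′ : ∀ {u} → u ∈ z ∷ zs → x < u → y ≤ u
  least′ (here refl) x<u = ⊥-elim (x≮z x<u)
  least′ (there u∈zs) x<u = least u∈zs x<u

firstGT-nothing : ∀ {x u} ys → firstGT x ys ≡ nothing → u ∈ ys → u ≤ x
firstGT-nothing {x} (z ∷ zs) eq u∈ with x <ᵇ z | <ᵇ-reflects-< x z
firstGT-nothing (z ∷ zs) eq (here refl)  | false | ofⁿ x≮z = ≮⇒≥ x≮z
firstGT-nothing (z ∷ zs) eq (there u∈zs) | false | ofⁿ _   = firstGT-nothing zs eq u∈zs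

PickResult : ℕ → List ℕ → Maybe (ℕ × Bool) → Set
PickResult x ys nothing         = ys ≡ []
PickResult x ys (just (y , w)) = Greedy (_∈ ys) (x , y , w)

pick-greedy : ∀ x ys → Increasing ys → PickResult x ys (pick x ys)
pick-greedy x ys ys↑ with firstGT x ys in eq
... | just y = firstGT-just ys ys↑ eq
pick-greedy x []       ys↑        | nothing = refl
pick-greedy x (y ∷ ys) (y< ∷ ys↑) | nothing = here refl , firstGT-nothing (y ∷ ys) eq , least
  where
  least : ∀ {u} → u ∈ y ∷ ys → y ≤ u
  least (here refl) = ≤-refl
  least (there u∈ys) = <⇒≤ (All.lookup y< u∈ys)

∈-remove⁻ : ∀ {y u} ys → u ∈ remove y ys → u ∈ ys × u ≢ y
∈-remove⁻ {y} (z ∷ zs) u∈ with z ≡ᵇ y | ≡ᵇ-reflects-≡ z y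
... | true | ofʸ _ = map₁ there (∈-remove⁻ zs u∈)
∈-remove⁻ (z ∷ zs) (here refl) | false | ofⁿ z≢y = here refl , z≢y
∈-remove⁻ (z ∷ zs) (there u∈)  | false | ofⁿ _   = map₁ there (∈-remove⁻ zs u∈)

∈-remove⁺ : ∀ {y u} ys → u ∈ ys → u ≢ y → u ∈ remove y ys
∈-remove⁺ {y} (z ∷ zs) u∈ u≢y with z ≡ᵇ y | ≡ᵇ-reflects-≡ z y
∈-remove⁺ (z ∷ zs) (here refl) u≢y | true  | ofʸ z≡y = ⊥-elim (u≢y z≡y)
∈-remove⁺ (z ∷ zs) (there u∈)  u≢y | true  | ofʸ _   = ∈-remove⁺ zs u∈ u≢y
∈-remove⁺ (z ∷ zs) (here refl) u≢y | false | ofⁿ _   = here refl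
∈-remove⁺ (z ∷ zs) (there u∈)  u≢y | false | ofⁿ _   = there (∈-remove⁺ zs u∈ u≢y)

remove-increasing : ∀ {y} ys → Increasing ys → Increasing (remove y ys)
remove-increasing {y} ys = AllPairsₚ.filter⁺ (T? ∘ λ z → not (z ≡ᵇ y))

remove-∉ : ∀ {y} ys → y ∉ ys → remove y ys ≡ ys
remove-∉ [] _ = refl
remove-∉ {y} (z ∷ zs) y∉ with z ≡ᵇ y | ≡ᵇ-reflects-≡ z y
... | true  | ofʸ refl = ⊥-elim (y∉ (here refl))
... | false | ofⁿ _    = cong (z ∷_) (remove-∉ zs (y∉ ∘′ there))

length-remove : ∀ {y} ys → Increasing ys → y ∈ ys → suc (length (remove y ys)) ≡ length ys
length-remove {y} (z ∷ zs) (z< ∷ zs↑) y∈ with z ≡ᵇ y | ≡ᵇ-reflects-≡ z y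
... | true  | ofʸ refl = cong (suc ∘′ length) (remove-∉ zs λ y∈zs → <-irrefl refl (All.lookup z< y∈zs))
length-remove (z ∷ zs) _          (here refl) | false | ofⁿ z≢z = ⊥-elim (z≢z refl)
length-remove (z ∷ zs) (_ ∷ zs↑) (there y∈)  | false | ofⁿ _   = cong suc (length-remove zs zs↑ y∈)

record Tracks (X : List ℕ) (P : List Edge) (av : List ℕ) : Set where
  field
    increasing : Increasing av
    sound      : ∀ {u} → u ∈ av → Avail X P u
    complete   : ∀ {u} → Avail X P u → u ∈ av
    size       : length av + length P ≡ length X
    greedy     : GreedyRun X P

tracks-init : ∀ {X} → Increasing X → Tracks X [] X
tracks-init {X} X↑ = record
  { increasing = X↑
  ; sound      = λ u∈ → u∈ , λ ()
  ; complete   = proj₁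
  ; size       = +-identityʳ (length X)
  ; greedy     = greedyRun-[]
  }

tracks-∷ʳ : ∀ {X P av} e → Tracks X P av → Greedy (_∈ av) e → Tracks X (P ∷ʳ e) (remove (tgt e) av)
tracks-∷ʳ {X} {P} {av} e tr g = record
  { increasing = remove-increasing av increasing
  ; sound      = λ u∈ → let u∈av , u≢ = ∈-remove⁻ av u∈ in Avail-∷ʳ⁺ P e (sound u∈av) u≢
  ; complete   = λ a → ∈-remove⁺ av (complete (Avail-++⁻ P [ e ] a)) (Avail-++-≢ P e [] a)
  ; size       = size′
  ; greedy     = greedyRun-∷ʳ greedy (greedy-resp sound complete e g)
  }
  where
  open Tracks tr
  size′ : length (remove (tgt e) av) + length (P ∷ʳ e) ≡ length X
  size′ = begin
    length (remove (tgt e) av) + length (P ∷ʳ e)   ≡⟨ cong (_ +_) (trans (length-++ P) (+-comm (length P) 1)) ⟩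
    length (remove (tgt e) av) + suc (length P)    ≡⟨ +-suc _ (length P) ⟩
    suc (length (remove (tgt e) av)) + length P    ≡⟨ cong (_+ length P) (length-remove av increasing (greedy-target e g)) ⟩
    length av + length P                           ≡⟨ size ⟩
    length X                                       ∎
    where open ≡-Reasoning

tracks-room : ∀ {X P av} → Tracks X P av → length P < length X → ∃ λ u → u ∈ av
tracks-room {av = []}    tr P<X = ⊥-elim (<-irrefl (Tracks.size tr) P<X)
tracks-room {av = u ∷ _} _  _   = u , here refl

tracks-exhausted : ∀ {X P} → Tracks X P [] → ∀ {u} → u ∈ X → u ∈ map tgt P
tracks-exhausted {P = P} tr {u} u∈X with u ∈? map tgt P
... | yes u∈P = u∈P
... | no  u∉P with () ← Tracks.complete tr (u∈X , u∉P)

-- The bully procedure as two greedy runs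

memb-sound : ∀ {x} l → memb x l ≡ true → x ∈ l
memb-sound {x} (y ∷ l) eq with x ≡ᵇ y | ≡ᵇ-reflects-≡ x y
... | true  | ofʸ x≡y = here x≡y
... | false | ofⁿ _   = there (memb-sound l eq)

memb-complete : ∀ {x} l → x ∈ l → memb x l ≡ true
memb-complete {x} (y ∷ l) x∈ with x ≡ᵇ y | ≡ᵇ-reflects-≡ x y
memb-complete (y ∷ l) x∈          | true  | ofʸ _   = refl
memb-complete (y ∷ l) (here x≡y)  | false | ofⁿ x≢y = ⊥-elim (x≢y x≡y)
memb-complete (y ∷ l) (there x∈l) | false | ofⁿ _   = memb-complete l x∈l

labelOf-∉ : ∀ l {z} → z ∉ map proj₁ l → labelOf l z ≡ 3
labelOf-∉ [] _ = refl
labelOf-∉ ((u , k) ∷ l) {z} z∉ with u ≡ᵇ z | ≡ᵇ-reflects-≡ u z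
... | true  | ofʸ refl = ⊥-elim (z∉ (here refl))
... | false | ofⁿ _    = labelOf-∉ l (z∉ ∘′ there)

labelOf-∈ : ∀ l {z} → z ∈ map proj₁ l → (z , labelOf l z) ∈ l
labelOf-∈ ((u , k) ∷ l) {z} z∈ with u ≡ᵇ z | ≡ᵇ-reflects-≡ u z
labelOf-∈ ((u , k) ∷ l) z∈          | true  | ofʸ refl = here refl
labelOf-∈ ((u , k) ∷ l) (here z≡u)  | false | ofⁿ u≢z = ⊥-elim (u≢z (sym z≡u))
labelOf-∈ ((u , k) ∷ l) (there z∈l) | false | ofⁿ _   = there (labelOf-∈ l z∈l)

record Path : Set where
  constructor path
  field
    start  : ℕ
    wrap₁  : Bool
    middle : ℕ
    wrap₂  : Bool
    end    : ℕ
open Path public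

edge₁ edge₂ : Path → Edge
edge₁ p = start p , middle p , wrap₁ p
edge₂ p = middle p , end p , wrap₂ p

label₁ : Path → ℕ × ℕ
label₁ p = end p , 1

label₂ : Edge → ℕ × ℕ
label₂ e = tgt e , 2

record Phase₁ (B C : List ℕ) (T : List Path) (σ : State) : Set where
  field
    e12≡ : State.e12 σ ≡ map edge₁ T
    e23≡ : State.e23 σ ≡ map edge₂ T
    lab≡ : State.lab σ ≡ map label₁ T
    row₂ : Tracks B (map edge₁ T) (State.av2 σ)
    row₃ : Tracks C (map edge₂ T) (State.av3 σ)

phase₁-init : ∀ {B C} → Increasing B → Increasing C → Phase₁ B C [] (st B C [] [] [])
phase₁-init B↑ C↑ = record
  { e12≡ = refl ; e23≡ = refl ; lab≡ = refl ; row₂ = tracks-init B↑ ; row₃ = tracks-init C↑ }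

step1-phase₁ : ∀ {B C T} σ a → Phase₁ B C T σ → length T < length B → length T < length C →
  ∃ λ p → start p ≡ a × Phase₁ B C (T ∷ʳ p) (step1 σ a)
step1-phase₁ {B} {C} {T} (st a2 a3 f12 f23 lb) a I T<B T<C
  with pick a a2 | pick-greedy a a2 (Tracks.increasing (Phase₁.row₂ I))
... | nothing | refl with () ← proj₂ (tracks-room (Phase₁.row₂ I) (subst (_< _) (sym (length-map edge₁ T)) T<B))
... | just (y , w₁) | g₁ with pick y a3 | pick-greedy y a3 (Tracks.increasing (Phase₁.row₃ I))
...   | nothing | refl with () ← proj₂ (tracks-room (Phase₁.row₃ I) (subst (_< _) (sym (length-map edge₂ T)) T<C))
...   | just (z , w₂) | g₂ = path a w₁ y w₂ z , refl , record
  { e12≡ = extend edge₁ (e12≡ I)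
  ; e23≡ = extend edge₂ (e23≡ I)
  ; lab≡ = extend label₁ (lab≡ I)
  ; row₂ = subst (λ P → Tracks B P _) (sym (map-∷ʳ edge₁ T _)) (tracks-∷ʳ (a , y , w₁) (row₂ I) g₁)
  ; row₃ = subst (λ P → Tracks C P _) (sym (map-∷ʳ edge₂ T _)) (tracks-∷ʳ (y , z , w₂) (row₃ I) g₂)
  }
  where
  open Phase₁
  extend : ∀ {A : Set} {L p} (f : Path → A) → L ≡ map f T → L ∷ʳ f p ≡ map f (T ∷ʳ p)
  extend {p = p} f eq = trans (cong (_∷ʳ f p) eq) (sym (map-∷ʳ f T p))

foldl-step1-phase₁ : ∀ {B C} As σ T → Phase₁ B C T σ →
  length T + length As ≤ length B → length T + length As ≤ length C →
  ∃ λ T′ → Phase₁ B C T′ (foldl step1 σ As) × map start T′ ≡ map start T ++ As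
foldl-step1-phase₁ [] σ T I _ _ = T , I , sym (++-identityʳ _)
foldl-step1-phase₁ {B} {C} (a ∷ As) σ T I ≤B ≤C
  with p , refl , I′ ← step1-phase₁ σ a I (<-≤-trans (m<m+n _ (s≤s z≤n)) ≤B)
                                            (<-≤-trans (m<m+n _ (s≤s z≤n)) ≤C)
  with T′ , I″ , starts ← foldl-step1-phase₁ As (step1 σ (start p)) (T ∷ʳ p) I′
                            (subst (_≤ length B) (length-∷ʳ-+ T p As {start p}) ≤B)
                            (subst (_≤ length C) (length-∷ʳ-+ T p As {start p}) ≤C) =
  T′ , I″ , trans starts (trans (cong (_++ As) (map-∷ʳ start T p)) (∷ʳ-++ (map start T) (start p) As))

Exhausts : List ℕ → List Edge → Set
Exhausts C E = ∀ {u} → u ∈ C → u ∈ map tgt E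

StartsOrExhausted : List ℕ → List Path → List Edge → ℕ → Set
StartsOrExhausted C T E₂ x = x ∈ map src E₂ ⊎ Exhausts C (map edge₂ T ++ E₂)

startsOrExhausted-++ : ∀ {C T x} E₂ R → StartsOrExhausted C T E₂ x → StartsOrExhausted C T (E₂ ++ R) x
startsOrExhausted-++ E₂ R (inj₁ x∈) = inj₁ (subst (_ ∈_) (sym (map-++ src E₂ R)) (∈-++⁺ˡ x∈))
startsOrExhausted-++ {T = T} E₂ R (inj₂ ex) = inj₂ λ u∈C →
  subst (_ ∈_) (trans (sym (map-++ tgt (map edge₂ T ++ E₂) R)) (cong (map tgt) (++-assoc (map edge₂ T) E₂ R)))
        (∈-++⁺ˡ (ex u∈C))

record Phase₂ (C avail : List ℕ) (T : List Path) (E₂ : List Edge) (σ : State) : Set where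
  field
    e12≡    : State.e12 σ ≡ map edge₁ T
    e23≡    : State.e23 σ ≡ map edge₂ T ++ E₂
    lab≡    : State.lab σ ≡ map label₁ T ++ map label₂ E₂
    row₃    : Tracks C (map edge₂ T ++ E₂) (State.av3 σ)
    sources : All (λ e → src e ∈ avail) E₂

phase₂-init : ∀ {B C T σ} → Phase₁ B C T σ → Phase₂ C (State.av2 σ) T [] σ
phase₂-init {C = C} {T} I = record
  { e12≡    = e12≡
  ; e23≡    = trans e23≡ (sym (++-identityʳ _))
  ; lab≡    = trans lab≡ (sym (++-identityʳ _))
  ; row₃    = subst (λ P → Tracks C P _) (sym (++-identityʳ _)) row₃
  ; sources = []
  }
  where open Phase₁ I

step23-phase₂ : ∀ {C avail T E₂} σ y → Phase₂ C avail T E₂ σ → y ∈ avail →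
  ∃ λ E₂′ → Phase₂ C avail T E₂′ (step23 2 y σ) × (∃ λ R → E₂′ ≡ E₂ ++ R)
          × StartsOrExhausted C T E₂′ y
step23-phase₂ {E₂ = E₂} (st a2 a3 f12 f23 lb) y I y∈
  with pick y a3 | pick-greedy y a3 (Tracks.increasing (Phase₂.row₃ I))
... | nothing | refl = E₂ , I , ([] , sym (++-identityʳ E₂)) , inj₂ (tracks-exhausted (Phase₂.row₃ I))
step23-phase₂ {C} {avail} {T} {E₂} (st a2 a3 f12 f23 lb) y I y∈ | just (z , w) | g = E₂ ∷ʳ e , record
  { e12≡    = e12≡
  ; e23≡    = trans (cong (_∷ʳ e) e23≡) (++-assoc (map edge₂ T) E₂ [ e ])
  ; lab≡    = trans (cong (_∷ʳ label₂ e) lab≡)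
                (trans (++-assoc (map label₁ T) (map label₂ E₂) _)
                       (cong (map label₁ T ++_) (sym (map-∷ʳ label₂ E₂ e))))
  ; row₃    = subst (λ P → Tracks C P _) (++-assoc (map edge₂ T) E₂ [ e ]) (tracks-∷ʳ e row₃ g)
  ; sources = Allₚ.++⁺ sources (y∈ ∷ [])
  } , ([ e ] , refl) , inj₁ (subst (y ∈_) (sym (map-∷ʳ src E₂ e)) (∈-++⁺ʳ (map src E₂) (here refl)))
  where
  open Phase₂ I
  e : Edge
  e = y , z , w

foldl-step2-phase₂ : ∀ {C avail T} L σ E₂ → Phase₂ C avail T E₂ σ →
  ∃ λ E₂′ → Phase₂ C avail T E₂′ (foldl (step2 avail) σ L) × (∃ λ R → E₂′ ≡ E₂ ++ R)
          × (∀ {x} → x ∈ L → x ∈ avail → StartsOrExhausted C T E₂′ x)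
foldl-step2-phase₂ [] σ E₂ I = E₂ , I , ([] , sym (++-identityʳ E₂)) , λ ()
foldl-step2-phase₂ {C} {avail} {T} (y ∷ L) σ E₂ I with memb y avail in y-memb
... | false with E₂′ , I′ , ext , served ← foldl-step2-phase₂ L σ E₂ I = E₂′ , I′ , ext , served′
  where
  served′ : ∀ {x} → x ∈ y ∷ L → x ∈ avail → StartsOrExhausted C T E₂′ x
  served′ (here refl) y∈ with () ← trans (sym y-memb) (memb-complete avail y∈)
  served′ (there x∈L) = served x∈L
... | true
  with E₂₁ , I₁ , (R₁ , refl) , y-served ← step23-phase₂ σ y I (memb-sound avail y-memb)
  with E₂′ , I′ , (R₂ , refl) , served ← foldl-step2-phase₂ L (step23 2 y σ) E₂₁ I₁ =
  E₂′ , I′ , (R₁ ++ R₂ , ++-assoc E₂ R₁ R₂) , served′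
  where
  served′ : ∀ {x} → x ∈ y ∷ L → x ∈ avail → StartsOrExhausted C T E₂′ x
  served′ (here refl) _ = startsOrExhausted-++ {T = T} (E₂ ++ R₁) R₂ y-served
  served′ (there x∈L) = served x∈L

-- paths are the bully paths started in row 1, in order; extra are the bullying steps of the
-- paths started in row 2.
record Trace (A B C : List ℕ) : Set where
  field
    paths         : List Path
    extra         : List Edge
    e12≡          : State.e12 (bully A B C) ≡ map edge₁ paths
    e23≡          : State.e23 (bully A B C) ≡ map edge₂ paths ++ extra
    lab≡          : State.lab (bully A B C) ≡ map label₁ paths ++ map label₂ extra
    starts        : map start paths ≡ A
    greedy₂       : GreedyRun B (map edge₁ paths)
    greedy₃       : GreedyRun C (map edge₂ paths ++ extra)
    extra-sources : ∀ {e} → e ∈ extra → Avail B (map edge₁ paths) (src e)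
    covered       : ∀ {x} → x ∈ B → x ∈ map tgt (map edge₁ paths) ⊎ StartsOrExhausted C paths extra x
    spare         : ∃ (Avail B (map edge₁ paths))

bully-trace : ∀ {A B C} → Increasing B → Increasing C → length A < length B → length A ≤ length C → Trace A B C
bully-trace {A} {B} {C} B↑ C↑ A<B A≤C
  with T , I₁ , starts ← foldl-step1-phase₁ A _ [] (phase₁-init B↑ C↑) (<⇒≤ A<B) A≤C
  with E₂ , I₂ , _ , served ← foldl-step2-phase₂ B _ [] (phase₂-init I₁) = record
  { paths         = T
  ; extra         = E₂
  ; e12≡          = Phase₂.e12≡ I₂
  ; e23≡          = Phase₂.e23≡ I₂
  ; lab≡          = Phase₂.lab≡ I₂
  ; starts        = starts
  ; greedy₂       = Tracks.greedy row₂
  ; greedy₃       = Tracks.greedy (Phase₂.row₃ I₂)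
  ; extra-sources = λ e∈ → Tracks.sound row₂ (All.lookup (Phase₂.sources I₂) e∈)
  ; covered       = covered
  ; spare         = let u , u∈ = tracks-room row₂ T<B in u , Tracks.sound row₂ u∈
  }
  where
  row₂ : Tracks B (map edge₁ T) (State.av2 (foldl step1 (st B C [] [] []) A))
  row₂ = Phase₁.row₂ I₁
  T<B : length (map edge₁ T) < length B
  T<B = subst (_< length B) (sym (trans (length-map edge₁ T) (trans (sym (length-map start T)) (cong length starts)))) A<B
  covered : ∀ {x} → x ∈ B → x ∈ map tgt (map edge₁ T) ⊎ StartsOrExhausted C T E₂ x
  covered {x} x∈B with x ∈? map tgt (map edge₁ T)
  ... | yes bullied = inj₁ bullied
  ... | no  spared  = inj₂ (served x∈B (Tracks.complete row₂ (x∈B , spared)))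

module TraceProperties {A B C} (tr : Trace A B C) where
  open Trace tr

  F E : List Edge
  F = map edge₁ paths
  E = map edge₂ paths ++ extra

  Lab : List (ℕ × ℕ)
  Lab = State.lab (bully A B C)

  edge₁∈F : ∀ {p} → p ∈ paths → edge₁ p ∈ F
  edge₁∈F = ∈-map⁺ edge₁

  edge₂∈E : ∀ {p} → p ∈ paths → edge₂ p ∈ E
  edge₂∈E = ∈-++⁺ˡ ∘ ∈-map⁺ edge₂

  extra⊆E : ∀ {e} → e ∈ extra → e ∈ E
  extra⊆E = ∈-++⁺ʳ _

  middle-bullied : ∀ {p} → p ∈ paths → middle p ∈ map tgt F
  middle-bullied = ∈-map⁺ tgt ∘ edge₁∈F

  F-split : ∀ {pre p post} → paths ≡ pre ++ p ∷ post → F ≡ map edge₁ pre ++ edge₁ p ∷ map edge₁ post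
  F-split {pre} {p} {post} refl = map-++ edge₁ pre (p ∷ post)

  E-split : ∀ {pre p post} → paths ≡ pre ++ p ∷ post → E ≡ map edge₂ pre ++ edge₂ p ∷ (map edge₂ post ++ extra)
  E-split {pre} {p} {post} refl = trans (cong (_++ extra) (map-++ edge₂ pre (p ∷ post))) (++-assoc (map edge₂ pre) _ extra)

  E-cases : ∀ {pre p post e} → paths ≡ pre ++ p ∷ post → e ∈ E →
    (∃ λ q → q ∈ pre × e ≡ edge₂ q) ⊎ e ≡ edge₂ p ⊎ e ∈ map edge₂ post ++ extra
  E-cases {pre} eq e∈ with ∈-++⁻ (map edge₂ pre) (subst (_ ∈_) (E-split eq) e∈)
  ... | inj₁ e∈pre with q , q∈ , refl ← ∈-map⁻ edge₂ e∈pre = inj₁ (q , q∈ , refl)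
  ... | inj₂ (here refl) = inj₂ (inj₁ refl)
  ... | inj₂ (there e∈)  = inj₂ (inj₂ e∈)

  middle∈B : ∀ {p} → p ∈ paths → middle p ∈ B
  middle∈B p∈ with _ , _ , _ , g ← greedyRun-at greedy₂ (edge₁∈F p∈) = proj₁ (greedy-target _ g)

  source∈B : ∀ {e} → e ∈ E → src e ∈ B
  source∈B e∈ with ∈-++⁻ (map edge₂ paths) e∈
  ... | inj₁ e∈paths with _ , p∈ , refl ← ∈-map⁻ edge₂ e∈paths = middle∈B p∈
  ... | inj₂ e∈extra = proj₁ (extra-sources e∈extra)

  target∈C : ∀ {e} → e ∈ E → tgt e ∈ C
  target∈C e∈ with _ , _ , _ , g ← greedyRun-at greedy₃ e∈ = proj₁ (greedy-target _ g)

  source-or-exhausted : ∀ {x} → x ∈ B → (∃ λ e → e ∈ E × src e ≡ x) ⊎ Exhausts C E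
  source-or-exhausted x∈B with covered x∈B
  ... | inj₁ x∈F with _ , e∈F , refl ← ∈-map⁻ tgt x∈F with p , p∈ , refl ← ∈-map⁻ edge₁ e∈F =
    inj₁ (edge₂ p , edge₂∈E p∈ , refl)
  ... | inj₂ (inj₁ x∈extra) with e , e∈ , refl ← ∈-map⁻ src x∈extra = inj₁ (e , extra⊆E e∈ , refl)
  ... | inj₂ (inj₂ exhausted) = inj₂ exhausted

  untouched-avail : ∀ {z P R} → z ∈ C → z ∉ map tgt E → E ≡ P ++ R → Avail C P z
  untouched-avail {P = P} {R} z∈C z∉ eq = z∈C , λ z∈P →
    z∉ (subst (_ ∈_) (trans (sym (map-++ tgt P R)) (cong (map tgt) (sym eq))) (∈-++⁺ˡ z∈P))

  labelled : ∀ {z k} → (z , k) ∈ Lab →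
    (∃ λ p → p ∈ paths × z ≡ end p × k ≡ 1) ⊎ (∃ λ e → e ∈ extra × z ≡ tgt e × k ≡ 2)
  labelled zk∈ with ∈-++⁻ (map label₁ paths) (subst (_ ∈_) lab≡ zk∈)
  ... | inj₁ ∈paths with p , p∈ , refl ← ∈-map⁻ label₁ ∈paths = inj₁ (p , p∈ , refl , refl)
  ... | inj₂ ∈extra with e , e∈ , refl ← ∈-map⁻ label₂ ∈extra = inj₂ (e , e∈ , refl , refl)

  labels-targets : map proj₁ Lab ≡ map tgt E
  labels-targets = begin
    map proj₁ Lab                                                ≡⟨ cong (map proj₁) lab≡ ⟩
    map proj₁ (map label₁ paths ++ map label₂ extra)             ≡⟨ map-++ proj₁ (map label₁ paths) _ ⟩
    map proj₁ (map label₁ paths) ++ map proj₁ (map label₂ extra) ≡⟨ cong₂ _++_ (trans (sym (map-∘ paths)) (map-∘ paths))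
                                                                                  (sym (map-∘ extra)) ⟩
    map tgt (map edge₂ paths) ++ map tgt extra                   ≡⟨ map-++ tgt (map edge₂ paths) extra ⟨
    map tgt E                                                    ∎
    where open ≡-Reasoning

  label-3⇒untouched : ∀ {z} → labelOf Lab z ≡ 3 → z ∉ map tgt E
  label-3⇒untouched {z} three z∈
    with labelled (subst (λ k → (z , k) ∈ Lab) three (labelOf-∈ Lab (subst (z ∈_) (sym labels-targets) z∈)))
  ... | inj₁ (_ , _ , _ , ())
  ... | inj₂ (_ , _ , _ , ())

  untouched⇒label-3 : ∀ {z} → z ∉ map tgt E → labelOf Lab z ≡ 3
  untouched⇒label-3 {z} z∉ = labelOf-∉ Lab (z∉ ∘ subst (z ∈_) labels-targets)

  label-1⇒end : ∀ {z} → labelOf Lab z ≡ 1 → ∃ λ p → p ∈ paths × end p ≡ z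
  label-1⇒end {z} one with z ∈? map proj₁ Lab
  ... | no z∉ with () ← trans (sym (labelOf-∉ Lab z∉)) one
  ... | yes z∈ with labelled (subst (λ k → (z , k) ∈ Lab) one (labelOf-∈ Lab z∈))
  ...   | inj₁ (p , p∈ , refl , _) = p , p∈ , refl
  ...   | inj₂ (_ , _ , _ , ())

  end⇒label-1 : ∀ {p} → p ∈ paths → labelOf Lab (end p) ≡ 1
  end⇒label-1 {p} p∈
    with labelled (labelOf-∈ Lab (subst (end p ∈_) (sym labels-targets) (∈-map⁺ tgt (edge₂∈E p∈))))
  ... | inj₁ (_ , _ , _ , one) = one
  ... | inj₂ (e , e∈ , end≡ , _) with refl ← greedyRun-tgt-injective greedy₃ (edge₂∈E p∈) (extra⊆E e∈) end≡ =
    ⊥-elim (proj₂ (extra-sources e∈) (middle-bullied p∈))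

  bullies₁ : ∀ {p} → p ∈ paths → Bullies12 A B C (start p) (middle p)
  bullies₁ {p} p∈ = wrap₁ p , subst (_ ∈_) (sym e12≡) (edge₁∈F p∈)

  edge₂∈e23 : ∀ {p} → p ∈ paths → edge₂ p ∈ State.e23 (bully A B C)
  edge₂∈e23 p∈ = subst (_ ∈_) (sym e23≡) (edge₂∈E p∈)

  start-< : Increasing A → ∀ {pre q post p} → paths ≡ pre ++ q ∷ post → p ∈ pre → start p < start q
  start-< A↑ {pre} {q} {post} eq = increasing-before (map start pre) A′↑ ∘ ∈-map⁺ start
    where
    A′↑ : Increasing (map start pre ++ start q ∷ map start post)
    A′↑ = subst Increasing (trans (sym starts) (trans (cong (map start) eq) (map-++ start pre (q ∷ post)))) A↑

  ascends-before : Increasing A → ∀ {pre q post p} → paths ≡ pre ++ q ∷ post → start q < middle q →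
    p ∈ pre → start p < middle p × middle p < middle q
  ascends-before A↑ {q = q} {post} eq q↑ p∈ with pre₁ , pre₂ , refl ← ∈-∃++ p∈ =
    greedyRun-ascending-after greedy₂ (F-split (trans eq (++-assoc pre₁ (_ ∷ pre₂) (q ∷ post))))
      (∈-map⁺ edge₁ (∈-++⁺ʳ pre₂ (here refl))) q↑ (start-< A↑ eq p∈)

module Queue {s t n A B C} (cm : IsCMLQ s t n A B C) (1≤s : 1 ≤ s) (1≤t : 1 ≤ t) (s+t<n : s + t < n)
             (cₙ≡N : at C n ≡ n + s + s + t) (one-wrap : wraps23 A B C ≡ 1) where
  open IsCMLQ cm

  A↑ : Increasing A
  A↑ = Linked⇒AllPairs <-trans incA
  B↑ : Increasing B
  B↑ = Linked⇒AllPairs <-trans incB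
  C↑ : Increasing C
  C↑ = Linked⇒AllPairs <-trans incC

  -- Kept abstract so that with-abstractions do not unfold the simulation of the procedure.
  abstract
    tr : Trace A B C
    tr = bully-trace B↑ C↑ (subst₂ _<_ (sym lenA) (sym lenB) (m<m+n s 1≤t))
                           (subst₂ _≤_ (sym lenA) (sym lenC) (≤-trans (m≤m+n s t) (<⇒≤ s+t<n)))
  open Trace tr
  open TraceProperties tr

  entries-unique : Unique (A ++ B ++ C)
  entries-unique = unique-↭-upTo _ entries

  B∩C : ∀ {x y} → x ∈ B → y ∈ C → x ≢ y
  B∩C = unique-++-disjoint B (unique-++⁻ʳ A entries-unique)

  entry-≤ : ∀ {u} → u ∈ A ++ B ++ C → u ≤ n + s + s + t
  entry-≤ u∈ with i , i< , refl ← ∈-applyUpTo⁻ suc (∈-resp-↭ entries u∈) = i<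

  2≤s+t : 2 ≤ s + t
  2≤s+t = +-mono-≤ 1≤s 1≤t

  1≤s+t : 1 ≤ s + t
  1≤s+t = ≤-trans (s≤s z≤n) 2≤s+t

  s+t≤|B| : s + t ≤ length B
  s+t≤|B| = ≤-reflexive (sym lenB)

  2≤|C| : 2 ≤ length C
  2≤|C| = subst (2 ≤_) (sym lenC) (≤-trans 2≤s+t (<⇒≤ s+t<n))

  c₁ c₂ cₙ : ℕ
  c₁ = at C 1
  c₂ = at C 2
  cₙ = at C n

  c₂∈C : c₂ ∈ C
  c₂∈C = at-∈ C (s≤s z≤n) 2≤|C|
  cₙ∈C : cₙ ∈ C
  cₙ∈C = at-∈ C (≤-trans 1≤s+t (<⇒≤ s+t<n)) (≤-reflexive (sym lenC))

  c₁<c₂ : c₁ < c₂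
  c₁<c₂ = at-strictMono C↑ ≤-refl ≤-refl 2≤|C|

  below-c₂ : ∀ {u} → u ∈ C → u < c₂ → u ≡ c₁
  below-c₂ u∈ u<c₂ with k , 1≤k , k≤ , refl ← ∈⇒at u∈ with at-cancel-< C↑ (s≤s z≤n) k≤ u<c₂
  ... | s≤s (s≤s z≤n) = refl

  C≤cₙ : ∀ {u} → u ∈ C → u ≤ cₙ
  C≤cₙ u∈ = subst (_ ≤_) (sym cₙ≡N) (entry-≤ (∈-++⁺ʳ A (∈-++⁺ʳ B u∈)))

  B<cₙ : ∀ {u} → u ∈ B → u < cₙ
  B<cₙ u∈ = ≤∧≢⇒< (subst (_ ≤_) (sym cₙ≡N) (entry-≤ (∈-++⁺ʳ A (∈-++⁺ˡ u∈)))) (B∩C u∈ cₙ∈C)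

  b₁ y v : ℕ
  b₁ = at B 1
  y  = at B (s + t)
  v  = at B (s + t ∸ 1)

  b₁∈B : b₁ ∈ B
  b₁∈B = at-∈ B ≤-refl (≤-trans 1≤s+t s+t≤|B|)

  b₁≤B : ∀ {u} → u ∈ B → b₁ ≤ u
  b₁≤B u∈ with k , 1≤k , k≤ , refl ← ∈⇒at u∈ = at-mono B↑ ≤-refl 1≤k k≤

  y∈B : y ∈ B
  y∈B = at-∈ B 1≤s+t s+t≤|B|

  B≤y : ∀ {u} → u ∈ B → u ≤ y
  B≤y u∈ with k , 1≤k , k≤ , refl ← ∈⇒at u∈ = at-mono B↑ 1≤k (subst (_ ≤_) lenB k≤) s+t≤|B|

  1≤s+t∸1 : 1 ≤ s + t ∸ 1
  1≤s+t∸1 = ∸-monoˡ-≤ 1 2≤s+t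

  v∈B : v ∈ B
  v∈B = at-∈ B 1≤s+t∸1 (≤-trans (<⇒≤ (pred-< 1≤s+t)) s+t≤|B|)

  v<y : v < y
  v<y = at-strictMono B↑ 1≤s+t∸1 (pred-< 1≤s+t) s+t≤|B|

  below-y : ∀ {u} → u ∈ B → u < y → u ≤ v
  below-y u∈ u<y with k , 1≤k , k≤ , refl ← ∈⇒at u∈ =
    at-mono B↑ 1≤k (∸-monoˡ-≤ 1 (at-cancel-< B↑ 1≤s+t k≤ u<y)) (≤-trans (m∸n≤m _ 1) s+t≤|B|)

  abstract
    the-wrap : ∃ λ w → w ∈ E × isWrap w ≡ true × ∀ {e} → e ∈ E → isWrap e ≡ true → e ≡ w
    the-wrap = filterᵇ-unique isWrap E (subst (λ L → length (filterᵇ isWrap L) ≡ 1) e23≡ one-wrap)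

  w : Edge
  w = proj₁ the-wrap

  w∈E : w ∈ E
  w∈E = proj₁ (proj₂ the-wrap)

  w-wraps : isWrap w ≡ true
  w-wraps = proj₁ (proj₂ (proj₂ the-wrap))

  wrap-unique : ∀ {e} → e ∈ E → isWrap e ≡ true → e ≡ w
  wrap-unique = proj₂ (proj₂ (proj₂ the-wrap))

  Conditions : Set
  Conditions = (∃ λ i → 1 ≤ i × i < s
                 × Bullies12 A B C (at A i) v
                 × Bullies23 A B C v cₙ
                 × Bullies12 A B C (at A (suc i)) y
                 × (y , c₁ , true) ∈ State.e23 (bully A B C))
             × c₂ < b₁

  module Forward (ω₁ : ω A B C 1 ≡ 1) (ω₂ : ω A B C 2 ≡ 3) where

    c₂-untouched : c₂ ∉ map tgt E
    c₂-untouched = label-3⇒untouched ω₂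

    c₂-avail : ∀ {P R} → E ≡ P ++ R → Avail C P c₂
    c₂-avail = untouched-avail c₂∈C c₂-untouched

    source-of : ∀ {x} → x ∈ B → ∃ λ e → e ∈ E × src e ≡ x
    source-of x∈B with source-or-exhausted x∈B
    ... | inj₁ source    = source
    ... | inj₂ exhausted = ⊥-elim (c₂-untouched (exhausted c₂∈C))

    -- c₂ is never bullied, so it is still available when w happens.
    w-from-above-c₂-to-c₁ : c₂ < src w × tgt w ≡ c₁
    w-from-above-c₂-to-c₁ with P , _ , eq , g ← greedyRun-at greedy₃ w∈E
                          with _ , low , least ← greedy-wrap w w-wraps g =
      ≤∧≢⇒< (low (c₂-avail eq)) (B∩C (source∈B w∈E) c₂∈C ∘ sym) ,
      below-c₂ (target∈C w∈E) (≤∧≢⇒< (least (c₂-avail eq)) λ tgt≡c₂ →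
        c₂-untouched (subst (_∈ map tgt E) tgt≡c₂ (∈-map⁺ tgt w∈E)))

    -- A step from below c₂ would land on c₁, the target of w.
    sources-above-c₂ : ∀ {e} → e ∈ E → c₂ < src e
    sources-above-c₂ {e} e∈ with P , _ , eq , g ← greedyRun-at greedy₃ e∈ with greedy-cases e g
    ... | inj₂ (wraps , _) = subst (λ e → c₂ < src e) (sym (wrap-unique e∈ wraps)) (proj₁ w-from-above-c₂-to-c₁)
    ... | inj₁ (steps , _ , _ , least) = ≤∧≢⇒< (≮⇒≥ not-below) (B∩C (source∈B e∈) c₂∈C ∘ sym)
      where
      not-below : ¬ src e < c₂
      not-below e<c₂ with tgt e ≟ c₂
      ... | yes tgt≡c₂ = c₂-untouched (subst (_∈ map tgt E) tgt≡c₂ (∈-map⁺ tgt e∈))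
      ... | no  tgt≢c₂ with e≡w ← greedyRun-tgt-injective greedy₃ e∈ w∈E
                         (trans (below-c₂ (target∈C e∈) (≤∧≢⇒< (least (c₂-avail eq) e<c₂) tgt≢c₂))
                                (sym (proj₂ w-from-above-c₂-to-c₁)))
        = contradiction (trans (sym steps) (trans (cong isWrap e≡w) w-wraps)) λ ()

    c₂<b₁ : c₂ < b₁
    c₂<b₁ with e , e∈ , src≡ ← source-of b₁∈B
      = subst (c₂ <_) src≡ (sources-above-c₂ e∈)

    abstract
      p₀-data : ∃ λ p₀ → p₀ ∈ paths × end p₀ ≡ c₁
      p₀-data = label-1⇒end ω₁

    p₀ : Path
    p₀ = proj₁ p₀-data

    p₀∈ : p₀ ∈ paths
    p₀∈ = proj₁ (proj₂ p₀-data)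

    edge₂-p₀≡w : edge₂ p₀ ≡ w
    edge₂-p₀≡w = greedyRun-tgt-injective greedy₃ (edge₂∈E p₀∈) w∈E
                   (trans (proj₂ (proj₂ p₀-data)) (sym (proj₂ w-from-above-c₂-to-c₁)))

    b : ℕ
    b = middle p₀

    c₂<b : c₂ < b
    c₂<b = subst (c₂ <_) (cong src (sym edge₂-p₀≡w)) (proj₁ w-from-above-c₂-to-c₁)

    abstract
      p₀-split : ∃₂ λ pre post → paths ≡ pre ++ p₀ ∷ post
      p₀-split = ∈-∃++ p₀∈

    pre post : List Path
    pre  = proj₁ p₀-split
    post = proj₁ (proj₂ p₀-split)

    paths≡ : paths ≡ pre ++ p₀ ∷ post
    paths≡ = proj₂ (proj₂ p₀-split)

    Q₀ : List Edge
    Q₀ = map edge₂ post ++ extra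

    Q₀⊆E : ∀ {e} → e ∈ Q₀ → e ∈ E
    Q₀⊆E e∈ = subst (_ ∈_) (sym (E-split paths≡)) (∈-++⁺ʳ _ (there e∈))

    wrap-source : ∀ {e} → e ∈ E → isWrap e ≡ true → src e ≡ b
    wrap-source e∈ wraps = cong src (trans (wrap-unique e∈ wraps) (sym edge₂-p₀≡w))

    nothing-above-b-after-p₀ : ∀ {e} → e ∈ Q₀ → ¬ b < src e
    nothing-above-b-after-p₀ e∈ b<e with greedyRun-wrap-or-ascending greedy₃ (Q₀⊆E e∈)
    ... | inj₁ wraps = <-irrefl (sym (wrap-source (Q₀⊆E e∈) wraps)) b<e
    ... | inj₂ e↑ with greedyRun-ascending-after greedy₃ (E-split paths≡) e∈ e↑ b<e
    ...   | b<c₁ , _ = <-asym (subst (b <_) (proj₂ (proj₂ p₀-data)) b<c₁) (<-trans c₁<c₂ c₂<b)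

    b-avail : Avail B (map edge₁ pre) b
    b-avail = greedy-target (edge₁ p₀) (greedy₂ _ _ _ (F-split paths≡))

    -- Had p₀ wrapped into row 2, a spare entry would lie above b and start a step after w.
    p₀-ascends : start p₀ < b
    p₀-ascends with greedy-cases (edge₁ p₀) (greedy₂ _ _ _ (F-split paths≡))
    ... | inj₁ (_ , _ , p₀↑ , _) = p₀↑
    ... | inj₂ (_ , _ , _ , least) with z , z∈B , z∉F ← spare with covered z∈B
    ...   | inj₁ z∈F = ⊥-elim (z∉F z∈F)
    ...   | inj₂ (inj₂ exhausted) = ⊥-elim (c₂-untouched (exhausted c₂∈C))
    ...   | inj₂ (inj₁ z∈) with e , e∈ , refl ← ∈-map⁻ src z∈ =
      ⊥-elim (nothing-above-b-after-p₀ (∈-++⁺ʳ _ e∈) (≤∧≢⇒< (least z-avail) λ b≡z →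
        z∉F (subst (_∈ map tgt F) b≡z (middle-bullied p₀∈))))
      where
      z-avail : Avail B (map edge₁ pre) (src e)
      z-avail = Avail-++⁻ (map edge₁ pre) _ (subst (λ P → Avail B P (src e)) (F-split paths≡) (z∈B , z∉F))

    -- y starts some edge; edges after w start at most at b, and earlier paths land below b.
    b≡y : b ≡ y
    b≡y = ≤-antisym (B≤y (middle∈B p₀∈)) (≮⇒≥ y≮b) where
      y≮b : ¬ b < y
      y≮b b<y with e , e∈ , src≡y ← source-of y∈B with E-cases paths≡ e∈
      ... | inj₁ (q , q∈pre , refl) =
        <-asym b<y (subst (_< b) src≡y (proj₂ (ascends-before A↑ paths≡ p₀-ascends q∈pre)))
      ... | inj₂ (inj₁ refl)        = <-irrefl src≡y b<y
      ... | inj₂ (inj₂ e∈Q₀)        = nothing-above-b-after-p₀ e∈Q₀ (subst (b <_) (sym src≡y) b<y)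

    cₙ-bullied-before-p₀ : ∃ λ pₙ → pₙ ∈ pre × end pₙ ≡ cₙ
    cₙ-bullied-before-p₀ with cₙ ∈? map tgt (map edge₂ pre)
    ... | yes cₙ∈ with e , e∈ , refl ← ∈-map⁻ tgt cₙ∈ with pₙ , pₙ∈ , refl ← ∈-map⁻ edge₂ e∈ =
      pₙ , pₙ∈ , refl
    ... | no  cₙ∉ with _ , low , _ ← greedy-wrap (edge₂ p₀) (trans (cong isWrap edge₂-p₀≡w) w-wraps)
                                      (greedy₃ _ _ _ (E-split paths≡)) =
      ⊥-elim (<⇒≱ (B<cₙ (middle∈B p₀∈)) (low (cₙ∈C , cₙ∉)))

    abstract
      pₙ-data : ∃ λ pₙ → pₙ ∈ pre × end pₙ ≡ cₙ
      pₙ-data = cₙ-bullied-before-p₀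

    pₙ : Path
    pₙ = proj₁ pₙ-data

    pₙ∈pre : pₙ ∈ pre
    pₙ∈pre = proj₁ (proj₂ pₙ-data)

    pₙ∈ : pₙ ∈ paths
    pₙ∈ = subst (pₙ ∈_) (sym paths≡) (∈-++⁺ˡ pₙ∈pre)

    abstract
      pₙ-split : ∃₂ λ pre₁ pre₂ → pre ≡ pre₁ ++ pₙ ∷ pre₂
      pₙ-split = ∈-∃++ pₙ∈pre

    pre₁ pre₂ : List Path
    pre₁ = proj₁ pₙ-split
    pre₂ = proj₁ (proj₂ pₙ-split)

    pre≡ : pre ≡ pre₁ ++ pₙ ∷ pre₂
    pre≡ = proj₂ (proj₂ pₙ-split)

    paths≡ₙ : paths ≡ pre₁ ++ pₙ ∷ (pre₂ ++ p₀ ∷ post)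
    paths≡ₙ = trans paths≡ (trans (cong (_++ p₀ ∷ post) pre≡) (++-assoc pre₁ (pₙ ∷ pre₂) (p₀ ∷ post)))

    βₙ : ℕ
    βₙ = middle pₙ

    βₙ<b : βₙ < b
    βₙ<b = proj₂ (ascends-before A↑ paths≡ p₀-ascends pₙ∈pre)

    pₙ-ascends : start pₙ < βₙ
    pₙ-ascends = proj₁ (ascends-before A↑ paths≡ p₀-ascends pₙ∈pre)

    Qₙ : List Edge
    Qₙ = map edge₂ (pre₂ ++ p₀ ∷ post) ++ extra

    Qₙ⊆E : ∀ {e} → e ∈ Qₙ → e ∈ E
    Qₙ⊆E e∈ = subst (_ ∈_) (sym (E-split paths≡ₙ)) (∈-++⁺ʳ _ (there e∈))

    -- Above βₙ, the greedy step of pₙ to the maximum cₙ leaves room only for the wrap.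
    ascents-after-pₙ : ∀ {e} → e ∈ Qₙ → βₙ < src e → src e ≡ b
    ascents-after-pₙ e∈ βₙ<e with greedyRun-wrap-or-ascending greedy₃ (Qₙ⊆E e∈)
    ... | inj₁ wraps = wrap-source (Qₙ⊆E e∈) wraps
    ... | inj₂ e↑ with greedyRun-ascending-after greedy₃ (E-split paths≡ₙ) e∈ e↑ βₙ<e
    ...   | _ , cₙ<tgt =
      ⊥-elim (<⇒≱ (subst (_< _) (proj₂ (proj₂ pₙ-data)) cₙ<tgt) (C≤cₙ (target∈C (Qₙ⊆E e∈))))

    bullied-before-p₀ : ∀ {p} → p ∈ pre → middle p ≢ b
    bullied-before-p₀ p∈ middle≡b = proj₂ b-avail (subst (_∈ _) middle≡b (∈-map⁺ tgt (∈-map⁺ edge₁ p∈)))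

    βₙ≡v : βₙ ≡ v
    βₙ≡v = ≤-antisym (below-y (middle∈B pₙ∈) (subst (βₙ <_) b≡y βₙ<b)) (≮⇒≥ v≮βₙ)
      where
      v≮βₙ : ¬ βₙ < v
      v≮βₙ βₙ<v with e , e∈ , src≡v ← source-of v∈B with E-cases paths≡ₙ e∈
      ... | inj₁ (q , q∈pre₁ , refl) =
        <-asym βₙ<v (subst (_< βₙ) src≡v (proj₂ (ascends-before A↑ paths≡ₙ pₙ-ascends q∈pre₁)))
      ... | inj₂ (inj₁ refl) = <-irrefl src≡v βₙ<v
      ... | inj₂ (inj₂ e∈Qₙ) =
        <-irrefl (trans (sym src≡v) (trans (ascents-after-pₙ e∈Qₙ (subst (βₙ <_) (sym src≡v) βₙ<v)) b≡y)) v<y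

    -- A path between pₙ and p₀ would start a step above βₙ, hence from b, which p₀ still found
    -- available.
    pre₂≡[] : pre₂ ≡ []
    pre₂≡[] with pre₂ in pre₂≡
    ... | []        = refl
    ... | pₘ ∷ rest = ⊥-elim (bullied-before-p₀ pₘ∈pre (ascents-after-pₙ edge₂-pₘ∈Qₙ βₙ<βₘ))
      where
      pₘ∈pre : pₘ ∈ pre
      pₘ∈pre = subst (pₘ ∈_) (sym pre≡) (∈-++⁺ʳ pre₁ (there (subst (pₘ ∈_) (sym pre₂≡) (here refl))))
      paths≡ₘ : paths ≡ (pre₁ ∷ʳ pₙ) ++ pₘ ∷ (rest ++ p₀ ∷ post)
      paths≡ₘ = trans paths≡ₙ (trans (cong (λ L → pre₁ ++ pₙ ∷ (L ++ p₀ ∷ post)) pre₂≡)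
                                     (sym (∷ʳ-++ pre₁ pₙ _)))
      βₙ<βₘ : βₙ < middle pₘ
      βₙ<βₘ = proj₂ (ascends-before A↑ paths≡ₘ (proj₁ (ascends-before A↑ paths≡ p₀-ascends pₘ∈pre))
                                     (∈-++⁺ʳ pre₁ (here refl)))
      edge₂-pₘ∈Qₙ : edge₂ pₘ ∈ Qₙ
      edge₂-pₘ∈Qₙ = ∈-++⁺ˡ (subst (λ L → edge₂ pₘ ∈ map edge₂ (L ++ p₀ ∷ post)) (sym pre₂≡) (here refl))

    paths≡′ : paths ≡ pre₁ ++ pₙ ∷ p₀ ∷ post
    paths≡′ = trans paths≡ₙ (cong (λ L → pre₁ ++ pₙ ∷ (L ++ p₀ ∷ post)) pre₂≡[])

    A≡ : A ≡ map start pre₁ ++ start pₙ ∷ start p₀ ∷ map start post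
    A≡ = trans (sym starts) (trans (cong (map start) paths≡′) (map-++ start pre₁ _))

    i : ℕ
    i = suc (length pre₁)

    aᵢ≡ : at A i ≡ start pₙ
    aᵢ≡ = trans (cong₂ at A≡ (cong suc (sym (length-map start pre₁)))) (at-++-∷ (map start pre₁))

    aᵢ₊₁≡ : at A (suc i) ≡ start p₀
    aᵢ₊₁≡ = trans (cong₂ at A≡ (cong (suc ∘ suc) (sym (length-map start pre₁)))) (at-++-∷-∷ (map start pre₁))

    i<s : i < s
    i<s = subst₂ _<_ (+-comm (length pre₁) 1) |paths|≡ (+-monoʳ-< (length pre₁) (s≤s (s≤s z≤n)))
      where
      |paths|≡ : length pre₁ + suc (suc (length post)) ≡ s
      |paths|≡ = trans (sym (length-++ pre₁)) (trans (cong length (sym paths≡′))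
                   (trans (sym (length-map start paths)) (trans (cong length starts) lenA)))

    conditions : Conditions
    conditions =
      ( i , s≤s z≤n , i<s
      , subst₂ (Bullies12 A B C) (sym aᵢ≡) βₙ≡v (bullies₁ pₙ∈)
      , subst₂ (Bullies23 A B C) βₙ≡v (proj₂ (proj₂ pₙ-data)) (wrap₂ pₙ , edge₂∈e23 pₙ∈)
      , subst₂ (Bullies12 A B C) (sym aᵢ₊₁≡) b≡y (bullies₁ p₀∈)
      , subst (_∈ State.e23 (bully A B C)) edge₂-p₀≡ (edge₂∈e23 p₀∈) )
      , c₂<b₁
      where
      edge₂-p₀≡ : edge₂ p₀ ≡ (y , c₁ , true)
      edge₂-p₀≡ = cong₂ _,_ b≡y (cong₂ _,_ (proj₂ (proj₂ p₀-data)) (trans (cong isWrap edge₂-p₀≡w) w-wraps))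

  module Backward {a w₁} (y-bullied : (a , y , w₁) ∈ State.e12 (bully A B C))
                  (y↷c₁ : (y , c₁ , true) ∈ State.e23 (bully A B C)) (c₂<b₁ : c₂ < b₁) where

    y↷c₁∈E : (y , c₁ , true) ∈ E
    y↷c₁∈E = subst ((y , c₁ , true) ∈_) e23≡ y↷c₁

    c₁-end : ∃ λ p → p ∈ paths × end p ≡ c₁
    c₁-end with ∈-++⁻ (map edge₂ paths) y↷c₁∈E
    ... | inj₁ ∈paths with p , p∈ , eq ← ∈-map⁻ edge₂ ∈paths = p , p∈ , sym (cong tgt eq)
    ... | inj₂ ∈extra = ⊥-elim (proj₂ (extra-sources ∈extra) (∈-map⁺ tgt (subst (_ ∈_) e12≡ y-bullied)))

    c₂-untouched : c₂ ∉ map tgt E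
    c₂-untouched c₂∈ with e , e∈ , c₂≡ ← ∈-map⁻ tgt c₂∈ with greedyRun-wrap-or-ascending greedy₃ e∈
    ... | inj₁ wraps = <-irrefl (trans (cong tgt (sym e≡y↷c₁)) (sym c₂≡)) c₁<c₂
      where
      e≡y↷c₁ : e ≡ (y , c₁ , true)
      e≡y↷c₁ = trans (wrap-unique e∈ wraps) (sym (wrap-unique y↷c₁∈E refl))
    ... | inj₂ e↑ =
      <-irrefl refl (<-≤-trans (<-trans (subst (src e <_) (sym c₂≡) e↑) c₂<b₁) (b₁≤B (source∈B e∈)))

    ω₁ : ω A B C 1 ≡ 1
    ω₁ with p , p∈ , end≡ ← c₁-end = subst (λ z → labelOf Lab z ≡ 1) end≡ (end⇒label-1 p∈)

    ω₂ : ω A B C 2 ≡ 3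
    ω₂ = untouched⇒label-3 c₂-untouched

proposition5p3 : (s t n : ℕ) → 1 ≤ s → 1 ≤ t → s + t < n →
    (A B C : List ℕ) → IsCMLQ s t n A B C →
    at C n ≡ n + s + s + t →
    wraps23 A B C ≡ 1 →
    ((ω A B C 1 ≡ 1 × ω A B C 2 ≡ 3)
      ⇔ ((∃ λ i → 1 ≤ i × i < s
            × Bullies12 A B C (at A i) (at B (s + t ∸ 1))
            × Bullies23 A B C (at B (s + t ∸ 1)) (at C n)
            × Bullies12 A B C (at A (suc i)) (at B (s + t))
            × (at B (s + t) , at C 1 , true) ∈ State.e23 (bully A B C))
         × at C 2 < at B 1))
proposition5p3 s t n 1≤s 1≤t s+t<n A B C cm cₙ≡N one-wrap = mk⇔ forward backward
  where
  open Queue cm 1≤s 1≤t s+t<n cₙ≡N one-wrap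
  forward : ω A B C 1 ≡ 1 × ω A B C 2 ≡ 3 → Conditions
  forward (ω₁ , ω₂) = Forward.conditions ω₁ ω₂
  backward : Conditions → ω A B C 1 ≡ 1 × ω A B C 2 ≡ 3
  backward ((_ , _ , _ , _ , _ , (_ , y-bullied) , y↷c₁) , c₂<b₁) =
    Backward.ω₁ y-bullied y↷c₁ c₂<b₁ , Backward.ω₂ y-bullied y↷c₁ c₂<b₁
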